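{- Let $k\ge1$ and $0\le \ell<2k$ be integers, let $G=(V,E)$ be a $(k,\ell)$-tight graph and let $P=\{V_1,\dots,V_p\}$ be a partition of $V$ into nonempty sets. If $\ell\in(k,2k)$, assume further that $|V_i|\ge 2$ for every $i$. Then at least $\ell(p-1)$ edges of $G$ have their endpoints in two different parts $V_i\neq V_j$.
   Context: All graphs are finite multigraphs (loops and parallel edges allowed). For a graph $G=(V,E)$ with $n=|V|$ and $m=|E|$, $G$ is $(k,\ell)$-sparse if every subset $V'\subseteq V$ with $n'=|V'|$ vertices spans (induces) at most $\max\{0,kn'-\ell\}$ edges (loops included). $G$ is $(k,\ell)$-tight if it is $(k,\ell)$-sparse and $m=kn-\ell$. -}

module Defs where

open import Data.Nat using (ℕ; _+_; _*_; _∸_; _≤_; _<_)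
open import Data.Fin using (Fin)
open import Data.Fin.Subset using (Subset; _∈_; ∣_∣)
open import Data.Fin.Subset.Properties using (_∈?_)
open import Data.List using (List; length; filter)
open import Data.Product using (_×_; _,_; Σ; ∃)
open import Relation.Binary.PropositionalEquality using (_≡_; _≢_)
open import Relation.Nullary using (¬_)
open import Relation.Nullary.Decidable using (_×-dec_; ¬?)
open import Data.Fin using (_≟_)

-- A finite multigraph on vertex set Fin n: a list of edges, each an
-- (unordered, but stored as an ordered) pair of endpoints.
-- Loops (u , u) and repeated entries (parallel edges) are allowed.
Graph : ℕ → Set
Graph n = List (Fin n × Fin n)

induced : ∀ {n} → Graph n → Subset n → ℕ
induced G V' = length (filter (λ e → (Data.Product.proj₁ e ∈? V') ×-dec (Data.Product.proj₂ e ∈? V')) G)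

-- (k,ℓ)-sparse: every V' spans at most max{0, k|V'| - ℓ} edges
-- (truncated subtraction on ℕ equals max{0, k n' - ℓ})
Sparse : ℕ → ℕ → ∀ {n} → Graph n → Set
Sparse k ℓ {n} G = (V' : Subset n) → induced G V' ≤ k * ∣ V' ∣ ∸ ℓ

-- (k,ℓ)-tight: sparse and m = k n - ℓ (as an integer equation, written in ℕ
-- as m + ℓ = k n)
Tight : ℕ → ℕ → ∀ {n} → Graph n → Set
Tight k ℓ {n} G = Sparse k ℓ G × (length G + ℓ ≡ k * n)

-- A partition of Fin n into p nonempty parts V_1..V_p, given by the
-- part-assignment map; nonemptiness of all parts = surjectivity.
IsPartition : ∀ {n} p → (Fin n → Fin p) → Set
IsPartition {n} p part = (i : Fin p) → ∃ λ (v : Fin n) → part v ≡ i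

partSize : ∀ {n p} → (Fin n → Fin p) → Fin p → ℕ
partSize {n} part i = length (filter (λ v → part v ≟ i) (Data.List.allFin n))

crossing : ∀ {n p} → Graph n → (Fin n → Fin p) → ℕ
crossing G part = length (filter (λ e → ¬? (part (Data.Product.proj₁ e) ≟ part (Data.Product.proj₂ e))) G)

{-# OPTIONS --safe #-}
module Submission where

-- Every edge is either crossing or spanned by exactly one part, so
-- m = c + Σᵢ i(Vᵢ), where c counts crossing edges and i(Vᵢ) the edges spanned
-- by Vᵢ.  Sparsity gives i(Vᵢ) ≤ k|Vᵢ| ∸ ℓ, and this truncated subtraction is
-- exact because the hypotheses force ℓ ≤ k|Vᵢ| (parts are nonempty, and have
-- at least two vertices when ℓ > k).  Summing, kn ∸ ℓ = m ≤ c + kn ∸ pℓ.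

open import Defs
open import Data.Nat.Properties
  using ( +-*-semiring; +-comm; +-assoc; *-comm; *-identityʳ; *-zeroʳ
        ; ≤-reflexive; ≤-trans; <⇒≤; ≮⇒≥; _<?_; +-mono-≤; +-monoˡ-≤
        ; +-cancelˡ-≤; +-cancelʳ-≤; *-monoʳ-≤; *-monoˡ-≤; m∸n+n≡m; module ≤-Reasoning)
open import Algebra.Properties.Semiring.Sum +-*-semiring
  using (sum-syntax; sum-cong-≗; sum-replicate-zero; ∑-distrib-+; *-distribˡ-sum)
open import Data.Bool using (true; false; if_then_else_)
open import Data.Fin using (Fin; zero; suc; _≟_)
open import Data.Fin.Subset using (Subset; _∈_; ∣_∣)
open import Data.Fin.Subset.Properties using (_∈?_)
open import Data.List using (List; []; _∷_; length; filter; allFin)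
import Data.List as List
open import Data.List.Properties using (filter-≐; filter-some; length-tabulate)
open import Data.List.Membership.Propositional using (lose)
open import Data.List.Membership.Propositional.Properties using (∈-allFin)
open import Data.Nat using (ℕ; zero; suc; _+_; _*_; _∸_; _≤_; _<_; z≤n)
open import Data.Product using (_×_; _,_; proj₁; proj₂)
open import Data.Vec using (tabulate)
open import Data.Vec.Properties using ([]=⇒lookup; lookup⇒[]=; lookup∘tabulate)
open import Level using (Level)
open import Function using (_∘_; id)
open import Relation.Nullary using (Dec; yes; no; does; ¬?; contradiction)
open import Relation.Nullary.Decidable using (_×-dec_)
open import Relation.Unary using (Pred; Decidable; _≐_)
open import Relation.Binary.PropositionalEquality
  using (_≡_; _≢_; refl; sym; trans; cong; cong₂; module ≡-Reasoning)

private
  variable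
    a p : ℕ
    r : Level
    A : Set
    P : Pred A r

𝟙 : {B : Set} → Dec B → ℕ
𝟙 d = if does d then 1 else 0

length-filter-∷ : (P? : Decidable P) (x : A) (xs : List A) →
  length (filter P? (x ∷ xs)) ≡ 𝟙 (P? x) + length (filter P? xs)
length-filter-∷ P? x xs with does (P? x)
... | true  = refl
... | false = refl

∑-𝟙-≟ : (j : Fin p) → ∑[ i < p ] 𝟙 (j ≟ i) ≡ 1
∑-𝟙-≟ {suc p} zero    = cong suc (sum-replicate-zero p)
∑-𝟙-≟         (suc j) = ∑-𝟙-≟ j

∑-const : ∀ p c → ∑[ i < p ] c ≡ p * c
∑-const zero    c = refl
∑-const (suc p) c = cong (c +_) (∑-const p c)

∑-mono-≤ : {f g : Fin p → ℕ} → (∀ i → f i ≤ g i) → ∑[ i < p ] f i ≤ ∑[ i < p ] g i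
∑-mono-≤ {zero}  f≤g = z≤n
∑-mono-≤ {suc p} f≤g = +-mono-≤ (f≤g zero) (∑-mono-≤ (f≤g ∘ suc))

length≡∑-length-fibres : (f : A → Fin p) (xs : List A) →
  length xs ≡ ∑[ i < p ] length (filter (λ x → f x ≟ i) xs)
length≡∑-length-fibres {p = p} f [] = sym (sum-replicate-zero p)
length≡∑-length-fibres {p = p} f (x ∷ xs) = begin
  1 + length xs
    ≡⟨ cong₂ _+_ (sym (∑-𝟙-≟ (f x))) (length≡∑-length-fibres f xs) ⟩
  ∑[ i < p ] 𝟙 (f x ≟ i) + ∑[ i < p ] length (filter (λ y → f y ≟ i) xs)
    ≡⟨ ∑-distrib-+ (λ i → 𝟙 (f x ≟ i)) (λ i → length (filter (λ y → f y ≟ i) xs)) ⟨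
  ∑[ i < p ] (𝟙 (f x ≟ i) + length (filter (λ y → f y ≟ i) xs))
    ≡⟨ sum-cong-≗ (λ i → sym (length-filter-∷ (λ y → f y ≟ i) x xs)) ⟩
  ∑[ i < p ] length (filter (λ y → f y ≟ i) (x ∷ xs))
    ∎
  where open ≡-Reasoning

toSubset : {P : Pred (Fin a) r} → Decidable P → Subset a
toSubset P? = tabulate (does ∘ P?)

module _ {P : Pred (Fin a) r} (P? : Decidable P) where

  ∈-toSubset⁺ : ∀ {v} → P v → v ∈ toSubset P?
  ∈-toSubset⁺ {v} Pv with P? v in eq
  ... | yes _ = lookup⇒[]= v _ (trans (lookup∘tabulate (does ∘ P?) v) (cong does eq))
  ... | no ¬Pv = contradiction Pv ¬Pv

  ∈-toSubset⁻ : ∀ {v} → v ∈ toSubset P? → P v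
  ∈-toSubset⁻ {v} v∈ with P? v | trans (sym (lookup∘tabulate (does ∘ P?) v)) ([]=⇒lookup v∈)
  ... | yes Pv | _ = Pv
  ... | no _   | ()

∣tabulate-does∣ : (P? : Decidable P) (f : Fin a → A) →
  ∣ tabulate (does ∘ P? ∘ f) ∣ ≡ length (filter P? (List.tabulate f))
∣tabulate-does∣ {a = zero}  P? f = refl
∣tabulate-does∣ {a = suc a} P? f with does (P? (f zero))
... | true  = cong suc (∣tabulate-does∣ P? (f ∘ suc))
... | false = ∣tabulate-does∣ P? (f ∘ suc)

∣toSubset∣ : {P : Pred (Fin a) r} (P? : Decidable P) →
  ∣ toSubset P? ∣ ≡ length (filter P? (allFin a))
∣toSubset∣ P? = ∣tabulate-does∣ P? id

partSubset : (Fin a → Fin p) → Fin p → Subset a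
partSubset part i = toSubset (λ v → part v ≟ i)

module _ (part : Fin a → Fin p) {i : Fin p} {v : Fin a} where

  ∈-partSubset⁺ : part v ≡ i → v ∈ partSubset part i
  ∈-partSubset⁺ = ∈-toSubset⁺ (λ w → part w ≟ i)

  ∈-partSubset⁻ : v ∈ partSubset part i → part v ≡ i
  ∈-partSubset⁻ = ∈-toSubset⁻ (λ w → part w ≟ i)

∣partSubset∣ : (part : Fin a → Fin p) (i : Fin p) → ∣ partSubset part i ∣ ≡ partSize part i
∣partSubset∣ part i = ∣toSubset∣ (λ v → part v ≟ i)

∑-partSize : (part : Fin a → Fin p) → ∑[ i < p ] partSize part i ≡ a
∑-partSize {a} part = trans (sym (length≡∑-length-fibres part (allFin a))) (length-tabulate id)

partSize-nonempty : {part : Fin a → Fin p} → IsPartition p part → ∀ i → 1 ≤ partSize part i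
partSize-nonempty surj i with surj i
... | v , part-v≡i = filter-some (λ w → _ ≟ i) (lose (∈-allFin v) part-v≡i)

-- The crossing edges form the extra class zero, so the fibres of edgeClass partition E.
edgeClass : (Fin a → Fin p) → Fin a × Fin a → Fin (suc p)
edgeClass part (u , v) with part u ≟ part v
... | yes _ = suc (part u)
... | no  _ = zero

module _ (part : Fin a → Fin p) where

  edgeClass≡zero : (λ e → edgeClass part e ≡ zero) ≐ (λ e → part (proj₁ e) ≢ part (proj₂ e))
  edgeClass≡zero = to , from
    where
    to : ∀ {e} → edgeClass part e ≡ zero → part (proj₁ e) ≢ part (proj₂ e)
    to {u , v} eq with part u ≟ part v
    to {u , v} () | yes _
    ... | no neq = neq
    from : ∀ {e} → part (proj₁ e) ≢ part (proj₂ e) → edgeClass part e ≡ zero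
    from {u , v} neq with part u ≟ part v
    ... | yes eq = contradiction eq neq
    ... | no _   = refl

  edgeClass≡suc : ∀ i → (λ e → edgeClass part e ≡ suc i) ≐
                        (λ e → proj₁ e ∈ partSubset part i × proj₂ e ∈ partSubset part i)
  edgeClass≡suc i = to , from
    where
    to : ∀ {e} → edgeClass part e ≡ suc i →
         proj₁ e ∈ partSubset part i × proj₂ e ∈ partSubset part i
    to {u , v} eq with part u ≟ part v
    to {u , v} refl | yes u~v = ∈-partSubset⁺ part refl , ∈-partSubset⁺ part (sym u~v)
    to {u , v} ()   | no _
    from : ∀ {e} → proj₁ e ∈ partSubset part i × proj₂ e ∈ partSubset part i →
           edgeClass part e ≡ suc i
    from {u , v} (u∈ , v∈) with part u ≟ part v
    ... | yes _ = cong suc (∈-partSubset⁻ part u∈)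
    ... | no u≁v =
      contradiction (trans (∈-partSubset⁻ part u∈) (sym (∈-partSubset⁻ part v∈))) u≁v

length≡crossing+∑induced : (part : Fin a → Fin p) (G : Graph a) →
  length G ≡ crossing G part + ∑[ i < p ] induced G (partSubset part i)
length≡crossing+∑induced part G =
  trans (length≡∑-length-fibres (edgeClass part) G)
        (cong₂ _+_ (cong length (filter-≐ (λ e → edgeClass part e ≟ zero) crossing?
                                          (edgeClass≡zero part) G))
                   (sum-cong-≗ λ i → cong length (filter-≐ (λ e → edgeClass part e ≟ suc i)
                                                            (inside? i) (edgeClass≡suc part i) G)))
  where
  crossing? : Decidable (λ e → part (proj₁ e) ≢ part (proj₂ e))
  crossing? e = ¬? (part (proj₁ e) ≟ part (proj₂ e))
  inside? : ∀ i → Decidable (λ e → proj₁ e ∈ partSubset part i × proj₂ e ∈ partSubset part i)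
  inside? i e = (proj₁ e ∈? partSubset part i) ×-dec (proj₂ e ∈? partSubset part i)

ℓ≤k*s : ∀ {k ℓ s} → ℓ < 2 * k → 1 ≤ s → (k < ℓ → 2 ≤ s) → ℓ ≤ k * s
ℓ≤k*s {k} {ℓ} {s} ℓ<2k 1≤s k<ℓ⇒2≤s with k <? ℓ
... | yes k<ℓ = begin
  ℓ      ≤⟨ <⇒≤ ℓ<2k ⟩
  2 * k  ≤⟨ *-monoˡ-≤ k (k<ℓ⇒2≤s k<ℓ) ⟩
  s * k  ≡⟨ *-comm s k ⟩
  k * s  ∎
  where open ≤-Reasoning
... | no k≮ℓ = begin
  ℓ      ≤⟨ ≮⇒≥ k≮ℓ ⟩
  k      ≡⟨ *-identityʳ k ⟨
  k * 1  ≤⟨ *-monoʳ-≤ k 1≤s ⟩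
  k * s  ∎
  where open ≤-Reasoning

m*n≤o+n⇒n*[m∸1]≤o : ∀ m n o → m * n ≤ o + n → n * (m ∸ 1) ≤ o
m*n≤o+n⇒n*[m∸1]≤o zero    n o _  = ≤-trans (≤-reflexive (*-zeroʳ n)) z≤n
m*n≤o+n⇒n*[m∸1]≤o (suc m) n o le = begin
  n * m  ≡⟨ *-comm n m ⟩
  m * n  ≤⟨ +-cancelʳ-≤ n (m * n) o (≤-trans (≤-reflexive (+-comm (m * n) n)) le) ⟩
  o      ∎
  where open ≤-Reasoning

crossing-lower-bound : ∀ k ℓ (G : Graph a) (part : Fin a → Fin p) → Tight k ℓ G →
  (∀ i → ℓ ≤ k * partSize part i) → ℓ * (p ∸ 1) ≤ crossing G part
crossing-lower-bound {a} {p} k ℓ G part (sparse , m+ℓ≡ka) ℓ≤ks =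
  m*n≤o+n⇒n*[m∸1]≤o p ℓ X (+-cancelˡ-≤ C (p * ℓ) (X + ℓ) C+pℓ≤C+X+ℓ)
  where
  open ≤-Reasoning
  V = partSubset part
  X = crossing G part
  C = ∑[ i < p ] induced G (V i)

  induced+ℓ≤k*partSize : ∀ i → induced G (V i) + ℓ ≤ k * partSize part i
  induced+ℓ≤k*partSize i = begin
    induced G (V i) + ℓ          ≤⟨ +-monoˡ-≤ ℓ (sparse (V i)) ⟩
    k * ∣ V i ∣ ∸ ℓ + ℓ          ≡⟨ cong (λ s → k * s ∸ ℓ + ℓ) (∣partSubset∣ part i) ⟩
    k * partSize part i ∸ ℓ + ℓ  ≡⟨ m∸n+n≡m (ℓ≤ks i) ⟩
    k * partSize part i          ∎

  C+pℓ≤C+X+ℓ : C + p * ℓ ≤ C + (X + ℓ)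
  C+pℓ≤C+X+ℓ = begin
    C + p * ℓ                              ≡⟨ cong (C +_) (∑-const p ℓ) ⟨
    C + ∑[ i < p ] ℓ                       ≡⟨ ∑-distrib-+ (λ i → induced G (V i)) (λ _ → ℓ) ⟨
    ∑[ i < p ] (induced G (V i) + ℓ)       ≤⟨ ∑-mono-≤ induced+ℓ≤k*partSize ⟩
    ∑[ i < p ] (k * partSize part i)       ≡⟨ *-distribˡ-sum k (partSize part) ⟨
    k * ∑[ i < p ] partSize part i         ≡⟨ cong (k *_) (∑-partSize part) ⟩
    k * a                                  ≡⟨ m+ℓ≡ka ⟨
    length G + ℓ                           ≡⟨ cong (_+ ℓ) (length≡crossing+∑induced part G) ⟩
    X + C + ℓ                              ≡⟨ cong (_+ ℓ) (+-comm X C) ⟩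
    C + X + ℓ                              ≡⟨ +-assoc C X ℓ ⟩
    C + (X + ℓ)                            ∎

lemma3 : (k ℓ : ℕ) → 1 ≤ k → ℓ < 2 * k →
    (n : ℕ) (G : Graph n) → Tight k ℓ G →
    (p : ℕ) (part : Fin n → Fin p) → IsPartition p part →
    (k < ℓ → (i : Fin p) → 2 ≤ partSize part i) →
    ℓ * (p ∸ 1) ≤ crossing G part
lemma3 k ℓ _ ℓ<2k n G tight p part surj large-parts =
  crossing-lower-bound k ℓ G part tight ℓ≤k*partSize
  where
  ℓ≤k*partSize : ∀ i → ℓ ≤ k * partSize part i
  ℓ≤k*partSize i = ℓ≤k*s ℓ<2k (partSize-nonempty surj i) (λ k<ℓ → large-parts k<ℓ i)
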